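{- Suppose $A\subseteq\mathbb{Z}_{\geq0}^n$ is finite, layer-decomposable, and $k$-compressed for all $k<i$. Then $A'=C_i(A)$ satisfies: (i) $A'$ is $k$-compressed for all $k\leq i$; (ii) $A'$ is layer-decomposable.
   Context: For finite $A\subseteq\mathbb{Z}^n$ the $i$-th bottom layer is $B_i(A)=\{x\in A:$ whenever $y\in A$ with $y_k=x_k$ for all $k\neq i$, then $y_i\geq x_i\}$. Define $A_1=B_1(A)$ and $A_i=B_i(A\setminus(A_1\cup\dots\cup A_{i-1}))$ for $2\le i\le n$; $A$ is layer-decomposable if $A=A_1\cup\dots\cup A_n$. For $A\subseteq\mathbb{Z}_{\ge0}^n$, the $i$-compression $C_i(A)$ is obtained by replacing each $x\in B_i(A)$ with the vector obtained from $x$ by setting its $i$-th coordinate to $0$. $A$ is $i$-compressed if $C_i(A)=A$, i.e. $B_i(A)=\{x\in A: x_i=0\}$. -}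

module Defs where

open import Data.Nat using (ℕ; _<_; _≤_)
open import Data.Fin using (Fin; toℕ; fromℕ<)
open import Data.Vec using (Vec; lookup; _[_]≔_)
open import Data.Product using (Σ; ∃; _×_)
open import Data.Sum using (_⊎_)
open import Data.Empty using (⊥)
open import Relation.Nullary using (¬_)
open import Relation.Binary.PropositionalEquality using (_≡_; _≢_)
open import Data.List using (List)
open import Data.List.Membership.Propositional using (_∈_)

-- points of ℤ_{≥0}^n, coordinates indexed 0..n-1 (paper's i ↔ Fin index i-1)
Point : ℕ → Set
Point n = Vec ℕ n

PSet : ℕ → Set₁
PSet n = Point n → Set

⟦_⟧ : ∀ {n} → List (Point n) → PSet n
⟦ A ⟧ x = x ∈ A

SameExcept : ∀ {n} → Fin n → Point n → Point n → Set
SameExcept i x y = ∀ k → k ≢ i → lookup y k ≡ lookup x k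

Bottom : ∀ {n} → Fin n → PSet n → PSet n
Bottom i S x = S x × (∀ y → S y → SameExcept i x y → lookup x i ≤ lookup y i)

-- remaining S m = S \ (A_1 ∪ … ∪ A_m) ; layerN S m = A_{m+1} (0-based index m)
mutual
  remaining : ∀ {n} → PSet n → ℕ → PSet n
  remaining S ℕ.zero x = S x
  remaining S (ℕ.suc m) x = remaining S m x × ¬ layerN S m x

  layerN : ∀ {n} → PSet n → ℕ → PSet n
  layerN {n} S m x = Σ (m < n) (λ m<n → Bottom (fromℕ< m<n) (remaining S m) x)

Layer : ∀ {n} → PSet n → Fin n → PSet n
Layer S i = layerN S (toℕ i)

-- S = A_1 ∪ … ∪ A_n  (each A_i ⊆ S holds by construction)
LayerDecomposable : ∀ {n} → PSet n → Set
LayerDecomposable {n} S = ∀ x → S x → ∃ λ (i : Fin n) → Layer S i x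

Compressed : ∀ {n} → Fin n → PSet n → Set
Compressed i S = ∀ x → (Bottom i S x → S x × lookup x i ≡ 0)
                     × (S x × lookup x i ≡ 0 → Bottom i S x)

Compress : ∀ {n} → Fin n → PSet n → PSet n
Compress i S y = ∃ λ x → S x × ((Bottom i S x × y ≡ x [ i ]≔ 0) ⊎ (¬ Bottom i S x × y ≡ x))

-- Call S zero-closed in direction k if zeroing the k-th coordinate of a point of S stays in S; for a
-- finite set this is the same as being k-compressed. Zeroing a coordinate k ≠ i commutes with C_i and
-- cannot turn a non-bottom point of an i-row into a bottom one, so C_i(A) stays zero-closed below i, and
-- it is zero-closed in direction i by construction. For a set zero-closed in every direction below j,
-- the first j layers are cut out by the coordinates below j: what remains after them is the set of its
-- points whose first j coordinates are positive. Hence a point of C_i(A) with a zero among its first i+1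
-- coordinates lies in the layer of the first such zero, while A and C_i(A) have the same points left
-- after their first i+1 layers (the non-bottom points of A in direction i with positive coordinates
-- below i). From there on the two layer constructions coincide, so C_i(A) inherits layer-decomposability.
module Submission where

open import Defs
open import Data.Nat using (ℕ; zero; suc; _<_; _≤_; _≤′_; ≤′-refl; ≤′-step; z≤n; s≤s; _≟_; _≤?_)
open import Data.Nat.Properties
  using (≤-refl; ≤-reflexive; ≤-pred; <⇒≤; <-irrefl; <-trans; <-≤-trans; ≰⇒>; ≤⇒≤′; n≤0⇒n≡0; n≢0⇒n>0
        ; m<n⇒m<1+n; m<1+n⇒m<n∨m≡n; m≤n⇒m<n∨m≡n)
open import Data.Fin using (Fin; toℕ; fromℕ<)
open import Data.Fin.Properties using (toℕ-fromℕ<; fromℕ<-toℕ; toℕ<n; toℕ-injective; <⇒≢; all?)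
  renaming (_≟_ to _≟ᶠ_)
open import Data.Vec using (lookup; _[_]≔_)
open import Data.Vec.Properties
  using (lookup∘update; lookup∘update′; []≔-commutes; []≔-idempotent; []≔-lookup; tabulate∘lookup; tabulate-cong)
open import Data.List using (List; filter)
open import Data.List.Membership.Propositional using (_∈_)
open import Data.List.Membership.Propositional.Properties using (∈-filter⁺; ∈-filter⁻)
import Data.List.Relation.Unary.All as All
open import Data.List.Extrema.Nat using (argmin; argmin-all; f[argmin]≤f[xs])
open import Data.Product using (∃; _×_; _,_; proj₁; proj₂)
open import Data.Sum using (_⊎_; inj₁; inj₂)
open import Function using (_∘_)
open import Relation.Nullary using (¬_; Dec; yes; no; ¬?; contradiction)
open import Relation.Nullary.Decidable using (_→-dec_)
open import Relation.Unary using (_⊆_; _≐_; _∩_; ∁)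
open import Relation.Unary.Properties using (≐-sym; ≐-trans)
open import Relation.Binary.PropositionalEquality

private
  variable
    n j m : ℕ
    i k : Fin n
    x y w : Point n
    S T : PSet n

lookup-ext : (∀ k → lookup x k ≡ lookup y k) → x ≡ y
lookup-ext {x = x} {y = y} eq = trans (sym (tabulate∘lookup x)) (trans (tabulate-cong eq) (tabulate∘lookup y))

SameExcept-refl : SameExcept i x x
SameExcept-refl _ _ = refl

SameExcept-trans : SameExcept i x y → SameExcept i y w → SameExcept i x w
SameExcept-trans x~y y~w k k≢i = trans (y~w k k≢i) (x~y k k≢i)

SameExcept-zero : (x : Point n) → SameExcept i x (x [ i ]≔ 0)
SameExcept-zero x k k≢i = lookup∘update′ k≢i x 0

SameExcept-zero-cong : (k : Fin n) → SameExcept i x y → SameExcept i (x [ k ]≔ 0) (y [ k ]≔ 0)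
SameExcept-zero-cong {x = x} {y = y} k x~y j j≢i with j ≟ᶠ k
... | yes refl = trans (lookup∘update j y 0) (sym (lookup∘update j x 0))
... | no j≢k = trans (lookup∘update′ j≢k y 0) (trans (x~y j j≢i) (sym (lookup∘update′ j≢k x 0)))

SameExcept-zero-≡ : SameExcept i x y → y [ i ]≔ 0 ≡ x [ i ]≔ 0
SameExcept-zero-≡ {i = i} {x = x} {y = y} x~y = lookup-ext coordinate
  where
  coordinate : ∀ k → lookup (y [ i ]≔ 0) k ≡ lookup (x [ i ]≔ 0) k
  coordinate k with k ≟ᶠ i
  ... | yes refl = trans (lookup∘update k y 0) (sym (lookup∘update k x 0))
  ... | no k≢i = SameExcept-zero-cong {x = x} {y = y} i x~y k k≢i

SameExcept? : (i : Fin n) (x y : Point n) → Dec (SameExcept i x y)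
SameExcept? i x y = all? (λ k → ¬? (k ≟ᶠ i) →-dec (lookup y k ≟ lookup x k))

ZeroClosed : Fin n → PSet n → Set
ZeroClosed k S = ∀ {x} → S x → S (x [ k ]≔ 0)

HasBottoms : Fin n → PSet n → Set
HasBottoms i S = ∀ {x} → S x → ∃ λ b → SameExcept i x b × Bottom i S b

ZeroClosed-≐ : S ≐ T → ZeroClosed k S → ZeroClosed k T
ZeroClosed-≐ (S⊆T , T⊆S) cl = S⊆T ∘ cl ∘ T⊆S

Bottom-≐ : S ≐ T → Bottom i S ≐ Bottom i T
Bottom-≐ (S⊆T , T⊆S) =
  (λ (sx , least) → S⊆T sx , λ y ty → least y (T⊆S ty)) ,
  (λ (tx , least) → T⊆S tx , λ y sy → least y (S⊆T sy))

zero⇒Bottom : lookup x k ≡ 0 → S x → Bottom k S x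
zero⇒Bottom x≡0 sx = sx , λ y _ _ → subst (_≤ lookup y _) (sym x≡0) z≤n

ZeroClosed⇒Compressed : ZeroClosed k S → Compressed k S
ZeroClosed⇒Compressed {k = k} cl x =
  (λ (sx , least) → sx , n≤0⇒n≡0 (subst (lookup x k ≤_) (lookup∘update k x 0) (least _ (cl sx) (SameExcept-zero x)))) ,
  (λ (sx , x≡0) → zero⇒Bottom x≡0 sx)

Compressed⇒ZeroClosed : HasBottoms k S → Compressed k S → ZeroClosed k S
Compressed⇒ZeroClosed {k = k} {S = S} bottoms compressed {x} sx with bottoms sx
... | b , x~b , b-bottom = subst S b≡x₀ (proj₁ b-bottom)
  where
  open ≡-Reasoning
  b≡x₀ : b ≡ x [ k ]≔ 0
  b≡x₀ = begin
    b                     ≡⟨ sym ([]≔-lookup b k) ⟩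
    b [ k ]≔ lookup b k   ≡⟨ cong (b [ k ]≔_) (proj₂ (proj₁ (compressed b) b-bottom)) ⟩
    b [ k ]≔ 0            ≡⟨ SameExcept-zero-≡ x~b ⟩
    x [ k ]≔ 0            ∎

list-HasBottoms : (A : List (Point n)) (i : Fin n) → HasBottoms i ⟦ A ⟧
list-HasBottoms {n = n} A i {x} x∈A = b , proj₂ b-in-row , proj₁ b-in-row , least
  where
  row : List (Point n)
  row = filter (SameExcept? i x) A
  b : Point n
  b = argmin (λ y → lookup y i) x row
  b-in-row : b ∈ A × SameExcept i x b
  b-in-row = argmin-all (λ y → lookup y i) {P = λ b → b ∈ A × SameExcept i x b}
                        (x∈A , SameExcept-refl {i = i} {x = x}) (All.tabulate (∈-filter⁻ (SameExcept? i x)))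
  least : ∀ y → y ∈ A → SameExcept i b y → lookup b i ≤ lookup y i
  least y y∈A b~y = All.lookup (f[argmin]≤f[xs] {f = λ y → lookup y i} x row)
    (∈-filter⁺ (SameExcept? i x) y∈A (SameExcept-trans {x = x} {y = b} {w = y} (proj₂ b-in-row) b~y))

module _ {i : Fin n} {S : PSet n} (bottoms : HasBottoms i S) where

  zero-∈-Compress : S y → Compress i S (y [ i ]≔ 0)
  zero-∈-Compress sy with bottoms sy
  ... | b , y~b , b-bottom = b , proj₁ b-bottom , inj₁ (b-bottom , sym (SameExcept-zero-≡ y~b))

  Compress-ZeroClosed : ZeroClosed i (Compress i S)
  Compress-ZeroClosed (w , sw , inj₁ (_ , refl)) =
    subst (Compress i S) (sym ([]≔-idempotent w i)) (zero-∈-Compress sw)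
  Compress-ZeroClosed (w , sw , inj₂ (_ , refl)) = zero-∈-Compress sw

  Bottom-reflects-zero : ZeroClosed k S → k ≢ i → S w → Bottom i S (w [ k ]≔ 0) → Bottom i S w
  Bottom-reflects-zero {k = k} {w = w} cl k≢i sw (_ , least) = sw , λ y sy w~y →
    subst₂ _≤_ (lookup∘update′ (k≢i ∘ sym) w 0) (lookup∘update′ (k≢i ∘ sym) y 0)
      (least _ (cl sy) (SameExcept-zero-cong {x = w} {y = y} k w~y))

  Compress-preserves-ZeroClosed : k ≢ i → ZeroClosed k S → ZeroClosed k (Compress i S)
  Compress-preserves-ZeroClosed {k = k} k≢i cl (w , sw , inj₁ (_ , refl)) =
    subst (Compress i S) ([]≔-commutes w k i k≢i) (zero-∈-Compress (cl sw))
  Compress-preserves-ZeroClosed k≢i cl (w , sw , inj₂ (¬bottom , refl)) =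
    _ , cl sw , inj₂ (¬bottom ∘ Bottom-reflects-zero cl k≢i sw , refl)

  Compress-ZeroClosed-upto : (∀ k → toℕ k < toℕ i → ZeroClosed k S) →
                             ∀ k → toℕ k ≤ toℕ i → ZeroClosed k (Compress i S)
  Compress-ZeroClosed-upto closed k k≤i with m≤n⇒m<n∨m≡n k≤i
  ... | inj₁ k<i = Compress-preserves-ZeroClosed (<⇒≢ k<i) (closed k k<i)
  ... | inj₂ k≡i rewrite toℕ-injective k≡i = Compress-ZeroClosed

PositiveBelow : ℕ → PSet n
PositiveBelow j x = ∀ k → toℕ k < j → 0 < lookup x k

PositiveBelow-suc : ∀ {n j} (k : Fin n) → toℕ k ≡ j →
                    PositiveBelow (suc j) ≐ PositiveBelow j ∩ (λ x → 0 < lookup x k)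
PositiveBelow-suc {n} {j} k k≡j = (λ {x} → to {x}) , (λ {x} → from {x})
  where
  to : PositiveBelow {n} (suc j) ⊆ PositiveBelow j ∩ (λ x → 0 < lookup x k)
  to positive = (λ k′ k′<j → positive k′ (m<n⇒m<1+n k′<j)) , positive k (s≤s (≤-reflexive k≡j))
  from : PositiveBelow j ∩ (λ x → 0 < lookup x k) ⊆ PositiveBelow {n} (suc j)
  from {x} (positive , xk-positive) k′ k′<1+j with m<1+n⇒m<n∨m≡n k′<1+j
  ... | inj₁ k′<j = positive k′ k′<j
  ... | inj₂ k′≡j = subst (λ q → 0 < lookup x q) (toℕ-injective (trans k≡j (sym k′≡j))) xk-positive

below⇒≢ : toℕ k < j → j ≤ toℕ i → k ≢ i
below⇒≢ k<j j≤i refl = <-irrefl refl (<-≤-trans k<j j≤i)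

PositiveBelow-ZeroClosed : j ≤ toℕ k → ZeroClosed k (PositiveBelow j)
PositiveBelow-ZeroClosed j≤k {x} positive k′ k′<j =
  subst (0 <_) (sym (lookup∘update′ (below⇒≢ k′<j j≤k) x 0)) (positive k′ k′<j)

Bottom-∩-PositiveBelow : ∀ {n j} {i : Fin n} {S : PSet n} → j ≤ toℕ i →
                         Bottom i (S ∩ PositiveBelow j) ≐ Bottom i S ∩ PositiveBelow j
Bottom-∩-PositiveBelow {n} {j} {i} j≤i =
  (λ { {x} ((sx , positive) , least) →
        (sx , λ y sy x~y → least y (sy , along-row {x} {y} x~y positive) x~y) , positive }) ,
  (λ ((sx , least) , positive) → (sx , positive) , λ y (sy , _) → least y sy)
  where
  along-row : {x y : Point n} → SameExcept i x y → PositiveBelow j x → PositiveBelow j y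
  along-row x~y positive k k<j = subst (0 <_) (sym (x~y k (below⇒≢ k<j j≤i))) (positive k k<j)

remaining-antitone : m ≤ j → remaining S j ⊆ remaining S m
remaining-antitone = go ∘ ≤⇒≤′
  where
  go : m ≤′ j → remaining S j ⊆ remaining S m
  go ≤′-refl = λ r → r
  go (≤′-step m≤j) = go m≤j ∘ proj₁

remaining-before-layer : remaining S m x → layerN S j x → m ≤ j
remaining-before-layer {m = m} {j = j} r layer with m ≤? j
... | yes m≤j = m≤j
... | no m≰j = contradiction layer (proj₂ (remaining-antitone (≰⇒> m≰j) r))

layerN-≐ : remaining S j ≐ remaining T j → layerN S j ≐ layerN T j
layerN-≐ eq = (λ (p , b) → p , proj₁ (Bottom-≐ eq) b) , (λ (p , b) → p , proj₂ (Bottom-≐ eq) b)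

remaining-≐-from : remaining S m ≐ remaining T m → m ≤ j → remaining S j ≐ remaining T j
remaining-≐-from eq = go ∘ ≤⇒≤′
  where
  go : _ ≤′ j → remaining _ j ≐ remaining _ j
  go ≤′-refl = eq
  go (≤′-step m≤j) with go m≤j
  ... | eq′ = (λ (r , ¬layer) → proj₁ eq′ r , ¬layer ∘ proj₂ (layerN-≐ eq′)) ,
              (λ (r , ¬layer) → proj₂ eq′ r , ¬layer ∘ proj₁ (layerN-≐ eq′))

Layer-≐ : Layer S k ≐ Bottom k (remaining S (toℕ k))
Layer-≐ {S = S} {k = k} =
  (λ {x} (p , b) → subst (λ q → Bottom q (remaining S (toℕ k)) x) (fromℕ<-toℕ k p) b) ,
  (λ {x} b → toℕ<n k , subst (λ q → Bottom q (remaining S (toℕ k)) x) (sym (fromℕ<-toℕ k (toℕ<n k))) b)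

remaining-PositiveBelow : j ≤ n → (∀ k → toℕ k < j → ZeroClosed k S) → remaining S j ≐ S ∩ PositiveBelow {n} j
remaining-PositiveBelow {j = zero} _ _ = (λ sx → sx , λ _ ()) , proj₁
remaining-PositiveBelow {j = suc j} {S = S} j<n closed = to , from
  where
  ih : remaining S j ≐ S ∩ PositiveBelow j
  ih = remaining-PositiveBelow (<⇒≤ j<n) (λ k k<j → closed k (m<n⇒m<1+n k<j))
  to : remaining S (suc j) ⊆ S ∩ PositiveBelow (suc j)
  to {x} (r , ¬layer) with proj₁ ih r
  ... | sx , positive = sx , proj₂ (PositiveBelow-suc (fromℕ< j<n) (toℕ-fromℕ< j<n)) {x}
          (positive , n≢0⇒n>0 (λ x≡0 → ¬layer (j<n , zero⇒Bottom x≡0 r)))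
  from : S ∩ PositiveBelow (suc j) ⊆ remaining S (suc j)
  from {x} (sx , positive) =
    proj₂ ih (sx , proj₁ (proj₁ (PositiveBelow-suc (fromℕ< j<n) (toℕ-fromℕ< j<n)) {x} positive)) , ¬layer
    where
    ¬layer : ¬ layerN S j x
    ¬layer (p , b) = <-irrefl refl (subst (0 <_) xₚ≡0 (positive (fromℕ< p) p<1+j))
      where
      p<1+j : toℕ (fromℕ< p) < suc j
      p<1+j = s≤s (≤-reflexive (toℕ-fromℕ< p))
      remaining-closed : ZeroClosed (fromℕ< p) (remaining S j)
      remaining-closed = ZeroClosed-≐ (≐-sym ih) (λ { {y} (sy , positive) →
        closed _ p<1+j sy , PositiveBelow-ZeroClosed (≤-reflexive (sym (toℕ-fromℕ< p))) {y} positive })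
      xₚ≡0 : lookup x (fromℕ< p) ≡ 0
      xₚ≡0 = proj₂ (proj₁ (ZeroClosed⇒Compressed remaining-closed x) b)

Layer-at-first-zero : (∀ k′ → toℕ k′ < toℕ k → ZeroClosed k′ S) →
                      S x → PositiveBelow (toℕ k) x → lookup x k ≡ 0 → Layer S k x
Layer-at-first-zero {k = k} {x = x} closed sx positive xk≡0 =
  proj₂ Layer-≐ (zero⇒Bottom xk≡0 (proj₂ (remaining-PositiveBelow (<⇒≤ (toℕ<n k)) closed) {x} (sx , positive)))

first-zero-or-PositiveBelow : (x : Point n) → j ≤ n →
  PositiveBelow j x ⊎ ∃ λ k → toℕ k < j × lookup x k ≡ 0 × PositiveBelow (toℕ k) x
first-zero-or-PositiveBelow {j = zero} x _ = inj₁ λ _ ()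
first-zero-or-PositiveBelow {j = suc j} x j<n with first-zero-or-PositiveBelow x (<⇒≤ j<n)
... | inj₂ (k , k<j , rest) = inj₂ (k , m<n⇒m<1+n k<j , rest)
... | inj₁ positive with lookup x (fromℕ< j<n) ≟ 0
...   | yes xj≡0 = inj₂ (fromℕ< j<n , s≤s (≤-reflexive (toℕ-fromℕ< j<n)) , xj≡0 ,
                         subst (λ m → PositiveBelow m x) (sym (toℕ-fromℕ< j<n)) positive)
...   | no xj≢0 = inj₁ (proj₂ (PositiveBelow-suc (fromℕ< j<n) (toℕ-fromℕ< j<n)) {x} (positive , n≢0⇒n>0 xj≢0))

layer-from-remaining : LayerDecomposable S → remaining S m ≐ remaining T m →
                       ∀ {x} → remaining T m x → ∃ λ k → Layer T k x
layer-from-remaining {S = S} {m = m} decomposable eq {x} r′ =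
  let r = proj₂ eq {x} r′
      (k , layer) = decomposable x (remaining-antitone {m = 0} {j = m} {S = S} z≤n r)
  in k , proj₁ (layerN-≐ (remaining-≐-from {m = m} {j = toℕ k} eq (remaining-before-layer {m = m} r layer))) {x} layer

LayerDecomposable-transfer : (∀ k → toℕ k < j → ZeroClosed k T) → j ≤ n → remaining S j ≐ remaining T j →
                             LayerDecomposable S → LayerDecomposable {n} T
LayerDecomposable-transfer {j = j} closed j≤n eq decomposable x tx with first-zero-or-PositiveBelow x j≤n
... | inj₂ (k , k<j , xk≡0 , positive) =
  k , Layer-at-first-zero (λ k′ k′<k → closed k′ (<-trans k′<k k<j)) tx positive xk≡0
... | inj₁ positive =
  layer-from-remaining {m = j} decomposable eq (proj₂ (remaining-PositiveBelow j≤n closed) {x} (tx , positive))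

remaining-suc-≐ : (∀ k → toℕ k < toℕ i → ZeroClosed k S) →
                  remaining S (suc (toℕ i)) ≐ (S ∩ ∁ (Bottom i S)) ∩ PositiveBelow (toℕ i)
remaining-suc-≐ {i = i} {S = S} closed =
  (λ {x} (r , ¬layer) → let (sx , positive) = proj₁ R {x} r in
     (sx , λ bottom → ¬layer (proj₂ L {x} (bottom , positive))) , positive) ,
  (λ {x} ((sx , ¬bottom) , positive) → proj₂ R {x} (sx , positive) , λ layer → ¬bottom (proj₁ (proj₁ L {x} layer)))
  where
  R : remaining S (toℕ i) ≐ S ∩ PositiveBelow (toℕ i)
  R = remaining-PositiveBelow (<⇒≤ (toℕ<n i)) closed
  L : Layer S i ≐ Bottom i S ∩ PositiveBelow (toℕ i)
  L = ≐-trans Layer-≐ (≐-trans (Bottom-≐ R) (Bottom-∩-PositiveBelow ≤-refl))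

Compress-∩-positive : Compress i S ∩ (λ x → 0 < lookup x i) ≐ S ∩ ∁ (Bottom i S)
Compress-∩-positive {i = i} =
  (λ { ((w , _ , inj₁ (_ , refl)) , positive) → contradiction (subst (0 <_) (lookup∘update i w 0) positive) (<-irrefl refl)
     ; ((_ , sx , inj₂ (¬bottom , refl)) , _) → sx , ¬bottom }) ,
  (λ (sx , ¬bottom) → (_ , sx , inj₂ (¬bottom , refl)) , n≢0⇒n>0 (λ x≡0 → ¬bottom (zero⇒Bottom x≡0 sx)))

Compress-∩-PositiveBelow-suc : Compress i S ∩ PositiveBelow (suc (toℕ i)) ≐
                               (S ∩ ∁ (Bottom i S)) ∩ PositiveBelow (toℕ i)
Compress-∩-PositiveBelow-suc {i = i} =
  (λ {x} (cx , positive) → let (below , xᵢ-positive) = proj₁ (PositiveBelow-suc i refl) {x} positive in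
     proj₁ Compress-∩-positive (cx , xᵢ-positive) , below) ,
  (λ {x} (s¬b , below) → let (cx , xᵢ-positive) = proj₂ Compress-∩-positive {x} s¬b in
     cx , proj₂ (PositiveBelow-suc i refl) {x} (below , xᵢ-positive))

remaining-Compress : HasBottoms i S → (∀ k → toℕ k < toℕ i → ZeroClosed k S) →
                     remaining S (suc (toℕ i)) ≐ remaining (Compress i S) (suc (toℕ i))
remaining-Compress {i = i} bottoms closed =
  ≐-trans (remaining-suc-≐ closed)
    (≐-trans (≐-sym Compress-∩-PositiveBelow-suc)
      (≐-sym (remaining-PositiveBelow (toℕ<n i) (λ k → Compress-ZeroClosed-upto bottoms closed k ∘ ≤-pred))))

lemma7 : ∀ {n} (A : List (Point n)) (i : Fin n)
    → LayerDecomposable ⟦ A ⟧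
    → (∀ (k : Fin n) → toℕ k < toℕ i → Compressed k ⟦ A ⟧)
    → (∀ (k : Fin n) → toℕ k ≤ toℕ i → Compressed k (Compress i ⟦ A ⟧))
    × LayerDecomposable (Compress i ⟦ A ⟧)
lemma7 A i decomposable compressed =
  (λ k → ZeroClosed⇒Compressed ∘ closed′ k) ,
  LayerDecomposable-transfer (λ k → closed′ k ∘ ≤-pred) (toℕ<n i) (remaining-Compress bottoms closed) decomposable
  where
  bottoms : HasBottoms i ⟦ A ⟧
  bottoms = list-HasBottoms A i
  closed : ∀ k → toℕ k < toℕ i → ZeroClosed k ⟦ A ⟧
  closed k = Compressed⇒ZeroClosed (list-HasBottoms A k) ∘ compressed k
  closed′ : ∀ k → toℕ k ≤ toℕ i → ZeroClosed k (Compress i ⟦ A ⟧)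
  closed′ = Compress-ZeroClosed-upto bottoms closed
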